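{- Let $N\ge1$ and $0\le r\le 2N$, and let $f$ be a vertex function on $\mathcal{C}_4^N$ supported on $\Sigma_r=\{v:d(v)=r\}$. Then $Cf=2(N-r)f$, where $C=A_-A_+-A_+A_-$.
   Context: Vertices of $\mathcal{C}_4^N$ are elements $v=(\ell_1,\dots,\ell_N)$ of $\mathbb{Z}_4^N$ with $\ell_i\in\{ -1,0,1,2\}$; $v\sim w$ iff $v-w=\pm e_k$ (mod 4) for some $k$, where $e_k$ is the $k$th standard generator. Levels: $d_k(v)=|\ell_k|$, $d(v)=\sum_kd_k(v)$ (path distance to $0$). Vertex functions are maps $\mathbb{Z}_4^N\to\mathbb{C}$. Outer adjacency: $(A_+f)(v)=\sum_{w\sim v,\ d(w)=d(v)-1}f(w)$; inner adjacency (adjoint of $A_+$): $(A_-f)(v)=\sum_{w\sim v,\ d(w)=d(v)+1}f(w)$. -}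

module Defs where

open import Level using (Level)
open import Algebra.Bundles using (CommutativeRing)
open import Data.Nat.Base as ℕ using (ℕ; zero; suc; _≡ᵇ_)
open import Data.Bool.Base using (Bool; true; false; if_then_else_)
open import Data.Fin.Base using (Fin; zero; suc)
open import Data.Vec.Base as Vec using (Vec; updateAt; lookup)

-- ℤ₄ represented by Fin 4 with representatives 0,1,2,3; the element 3 is -1.
Z4 : Set
Z4 = Fin 4

inc : Z4 → Z4
inc zero = suc zero
inc (suc zero) = suc (suc zero)
inc (suc (suc zero)) = suc (suc (suc zero))
inc (suc (suc (suc zero))) = zero

dec : Z4 → Z4
dec zero = suc (suc (suc zero))
dec (suc zero) = zero
dec (suc (suc zero)) = suc zero
dec (suc (suc (suc zero))) = suc (suc zero)

-- |ℓ| for ℓ ∈ {-1,0,1,2}: representatives 0,1,2,3 ↦ 0,1,2,1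
absZ4 : Z4 → ℕ
absZ4 zero = 0
absZ4 (suc zero) = 1
absZ4 (suc (suc zero)) = 2
absZ4 (suc (suc (suc zero))) = 1

Vertex : ℕ → Set
Vertex N = Vec Z4 N

level : ∀ {N} → Vertex N → ℕ
level v = Vec.sum (Vec.map absZ4 v)

plusE : ∀ {N} → Fin N → Vertex N → Vertex N
plusE k v = updateAt v k inc

minusE : ∀ {N} → Fin N → Vertex N → Vertex N
minusE k v = updateAt v k dec

module Cube {c ℓ : Level} (R : CommutativeRing c ℓ) where
  open CommutativeRing R using (Carrier; 0#; _+_; _-_)

  VFun : ℕ → Set c
  VFun N = Vertex N → Carrier

  ΣFin : ∀ {n} → (Fin n → Carrier) → Carrier
  ΣFin {zero} g = 0#
  ΣFin {suc n} g = g zero + ΣFin (λ k → g (suc k))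

  when : Bool → Carrier → Carrier
  when b x = if b then x else 0#

  -- Σ_{w ∼ v} [cond w] f w ; neighbours of v are exactly v ± e_k, k : Fin N
  -- (for N ≥ 1 these 2N vertices are pairwise distinct, since +1 ≠ -1 in ℤ₄)
  nbrSum : ∀ {N} → (Vertex N → Bool) → VFun N → Vertex N → Carrier
  nbrSum cond f v =
    ΣFin (λ k → when (cond (plusE k v)) (f (plusE k v))
              + when (cond (minusE k v)) (f (minusE k v)))

  A₊ : ∀ {N} → VFun N → VFun N
  A₊ f v = nbrSum (λ w → suc (level w) ≡ᵇ level v) f v

  A₋ : ∀ {N} → VFun N → VFun N
  A₋ f v = nbrSum (λ w → level w ≡ᵇ suc (level v)) f v

  Cop : ∀ {N} → VFun N → VFun N
  Cop f v = A₋ (A₊ f) v - A₊ (A₋ f) v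

  _·_ : ℕ → Carrier → Carrier
  zero · x = 0#
  suc n · x = x + n · x

-- Both adjacencies split as sums over the N coordinate directions of the corresponding
-- adjacencies of the 4-cycle acting on one coordinate, because whether a neighbour lies a
-- level above or below only depends on the level change in the coordinate that moved.
-- Operators acting along different coordinates commute, so in A₋A₊ − A₊A₋ only the
-- diagonal terms survive, and on the 4-cycle a direct check shows that coordinate k
-- contributes (2 − 2 d_k(v)) f(v). Summing over k gives C f = (2N − 2 d(v)) f pointwise for
-- every f; when f is supported on Σ_r both sides vanish off Σ_r.
{-# OPTIONS --safe #-}
module Submission where

open import Defs
open import Level using (Level)
open import Algebra.Bundles using (CommutativeRing)
open import Algebra.Properties.CommutativeSemigroup as CommutativeSemigroupProperties using ()
open import Data.Nat.Base as ℕ using (ℕ; zero; suc; _≡ᵇ_)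
import Data.Nat.Properties as ℕₚ
open import Data.Bool.Base using (Bool; true; false)
open import Data.Fin.Base using (Fin; zero; suc; punchIn)
open import Data.Fin.Properties using (punchInᵢ≢i)
open import Data.Vec.Base using ([]; _∷_; lookup; updateAt; _[_]≔_)
open import Data.Vec.Properties
  using ( updateAt-cong-local; lookup∘updateAt; lookup∘updateAt′
        ; []≔-idempotent; []≔-commutes; []≔-lookup )
open import Data.Vec.Functional using (Vector; removeAt; replicate)
open import Function.Base using (_∘_; const)
import Relation.Binary.PropositionalEquality as ≡
open ≡ using (_≡_; _≢_)
open import Relation.Nullary using (yes; no)

open CommutativeSemigroupProperties ℕₚ.+-commutativeSemigroup
  using () renaming (x∙yz≈y∙xz to m+[n+o]≡n+[m+o])

+-cancelʳ-≡ᵇ : ∀ m n o → (m ℕ.+ o ≡ᵇ n ℕ.+ o) ≡ (m ≡ᵇ n)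
+-cancelʳ-≡ᵇ m n o rewrite ℕₚ.+-comm m o | ℕₚ.+-comm n o = +-cancelˡ-≡ᵇ o
  where
  +-cancelˡ-≡ᵇ : ∀ o → (o ℕ.+ m ≡ᵇ o ℕ.+ n) ≡ (m ≡ᵇ n)
  +-cancelˡ-≡ᵇ zero    = ≡.refl
  +-cancelˡ-≡ᵇ (suc o) = +-cancelˡ-≡ᵇ o

levelExcept : ∀ {N} → Vertex N → Fin N → ℕ
levelExcept (x ∷ v) zero    = level v
levelExcept (x ∷ v) (suc k) = absZ4 x ℕ.+ levelExcept v k

level-split : ∀ {N} (v : Vertex N) k → level v ≡ absZ4 (lookup v k) ℕ.+ levelExcept v k
level-split (x ∷ v) zero    = ≡.refl
level-split (x ∷ v) (suc k) =
  ≡.trans (≡.cong (absZ4 x ℕ.+_) (level-split v k))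
          (m+[n+o]≡n+[m+o] (absZ4 x) (absZ4 (lookup v k)) (levelExcept v k))

level-[]≔ : ∀ {N} (v : Vertex N) k z → level (v [ k ]≔ z) ≡ absZ4 z ℕ.+ levelExcept v k
level-[]≔ (x ∷ v) zero    z = ≡.refl
level-[]≔ (x ∷ v) (suc k) z =
  ≡.trans (≡.cong (absZ4 x ℕ.+_) (level-[]≔ v k z))
          (m+[n+o]≡n+[m+o] (absZ4 x) (absZ4 z) (levelExcept v k))

ShiftInvariant : (ℕ → ℕ → Bool) → Set
ShiftInvariant t = ∀ m n o → t (m ℕ.+ o) (n ℕ.+ o) ≡ t m n

up down : ℕ → ℕ → Bool
up   m n = n ≡ᵇ suc m
down m n = suc n ≡ᵇ m

up-shiftInvariant : ShiftInvariant up
up-shiftInvariant m n o = +-cancelʳ-≡ᵇ n (suc m) o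

down-shiftInvariant : ShiftInvariant down
down-shiftInvariant m n o = +-cancelʳ-≡ᵇ (suc n) m o

onLevels : (ℕ → ℕ → Bool) → Z4 → Z4 → Bool
onLevels t z z′ = t (absZ4 z) (absZ4 z′)

outward inward : Z4 → Z4 → Bool
outward = onLevels up
inward  = onLevels down

onLevels-[]≔ : ∀ {t} → ShiftInvariant t → ∀ {N} (v : Vertex N) k z →
  t (level v) (level (v [ k ]≔ z)) ≡ onLevels t (lookup v k) z
onLevels-[]≔ {t} inv v k z =
  ≡.trans (≡.cong₂ t (level-split v k) (level-[]≔ v k z)) (inv _ _ (levelExcept v k))

module _ {c ℓ : Level} (R : CommutativeRing c ℓ) where
  open CommutativeRing R hiding (zero)
  open Cube R
  open import Algebra.Properties.CommutativeSemigroup +-commutativeSemigroup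
    using (interchange; xy∙z≈xz∙y)
  open import Algebra.Properties.CommutativeMonoid.Sum +-commutativeMonoid
    using ( sum; sum-cong-≋; sum-cong-≗; ∑-distrib-+; ∑-comm; sum-remove
          ; sum-replicate; sum-replicate-zero )
  open import Algebra.Properties.Monoid.Mult +-monoid using (_×_; ×-congʳ; ×-homo-+; ×-assocˡ)
  open import Algebra.Properties.Group +-group using (∙-cancelʳ)
  open import Algebra.Solver.CommutativeMonoid +-commutativeMonoid using (solve; _⊕_; _⊜_; id)
  open import Relation.Binary.Reasoning.Setoid setoid

  when-cong : ∀ b {x y} → x ≈ y → when b x ≈ when b y
  when-cong true  x≈y = x≈y
  when-cong false x≈y = refl

  when-+ : ∀ b x y → when b (x + y) ≈ when b x + when b y
  when-+ true  x y = refl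
  when-+ false x y = sym (+-identityʳ 0#)

  when-comm : ∀ a b x → when a (when b x) ≡ when b (when a x)
  when-comm true  true  x = ≡.refl
  when-comm true  false x = ≡.refl
  when-comm false true  x = ≡.refl
  when-comm false false x = ≡.refl

  when-sum : ∀ b {n} (h : Vector Carrier n) → when b (sum h) ≈ sum (λ j → when b (h j))
  when-sum true      h = refl
  when-sum false {n} h = sym (sum-replicate-zero n)

  sum-exchangeAt : ∀ {n} (k : Fin n) {h h′ : Vector Carrier n} {a b} →
    (∀ j → j ≢ k → h j ≈ h′ j) → h k + a ≈ b + h′ k → sum h + a ≈ b + sum h′
  sum-exchangeAt {suc n} k {h} {h′} {a} {b} agree exchange = begin
      sum h + a
    ≈⟨ +-congʳ (sum-remove {i = k} h) ⟩
      (h k + sum (removeAt h k)) + a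
    ≈⟨ xy∙z≈xz∙y _ _ _ ⟩
      (h k + a) + sum (removeAt h k)
    ≈⟨ +-cong exchange (sum-cong-≋ (λ j → agree (punchIn k j) (punchInᵢ≢i k j))) ⟩
      (b + h′ k) + sum (removeAt h′ k)
    ≈⟨ +-assoc _ _ _ ⟩
      b + (h′ k + sum (removeAt h′ k))
    ≈⟨ +-congˡ (sum-remove {i = k} h′) ⟨
      b + sum h′
    ∎

  ΣFin≡sum : ∀ {n} (g : Fin n → Carrier) → ΣFin g ≡ sum g
  ΣFin≡sum {zero}  g = ≡.refl
  ΣFin≡sum {suc n} g = ≡.cong (g zero +_) (ΣFin≡sum (λ k → g (suc k)))

  ·≡× : ∀ n x → n · x ≡ n × x
  ·≡× zero    x = ≡.refl
  ·≡× (suc n) x = ≡.cong (x +_) (·≡× n x)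

  x≈0⇒n·x≈0 : ∀ n {x} → x ≈ 0# → n · x ≈ 0#
  x≈0⇒n·x≈0 zero    x≈0 = refl
  x≈0⇒n·x≈0 (suc n) x≈0 = trans (+-cong x≈0 (x≈0⇒n·x≈0 n x≈0)) (+-identityʳ 0#)

  ×-double : ∀ n x → n × (x + x) ≈ (2 ℕ.* n) × x
  ×-double n x = begin
      n × (x + x)
    ≈⟨ ×-congʳ n (+-congˡ (sym (+-identityʳ x))) ⟩
      n × (2 × x)
    ≈⟨ ×-assocˡ x n 2 ⟩
      (n ℕ.* 2) × x
    ≡⟨ ≡.cong (_× x) (ℕₚ.*-comm n 2) ⟩
      (2 ℕ.* n) × x
    ∎

  x-y+[z+y]≈x+z : ∀ x y z → (x - y) + (z + y) ≈ x + z
  x-y+[z+y]≈x+z x y z = begin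
      (x - y) + (z + y)
    ≈⟨ interchange x (- y) z y ⟩
      (x + z) + (- y + y)
    ≈⟨ +-congˡ (-‿inverseˡ y) ⟩
      (x + z) + 0#
    ≈⟨ +-identityʳ (x + z) ⟩
      x + z
    ∎

  x+a≈b+y⇒x-y≈b-a : ∀ {x y a b} → x + a ≈ b + y → x - y ≈ b - a
  x+a≈b+y⇒x-y≈b-a {x} {y} {a} {b} x+a≈b+y = ∙-cancelʳ (a + y) (x - y) (b - a) (begin
      (x - y) + (a + y)
    ≈⟨ x-y+[z+y]≈x+z x y a ⟩
      x + a
    ≈⟨ x+a≈b+y ⟩
      b + y
    ≈⟨ x-y+[z+y]≈x+z b a y ⟨
      (b - a) + (y + a)
    ≈⟨ +-congˡ (+-comm y a) ⟩
      (b - a) + (a + y)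
    ∎)

  cycleAdj : (Z4 → Z4 → Bool) → (Z4 → Carrier) → Z4 → Carrier
  cycleAdj E g z = when (E z (inc z)) (g (inc z)) + when (E z (dec z)) (g (dec z))

  cycleAdj-cong : ∀ E {g h : Z4 → Carrier} → (∀ z → g z ≈ h z) → ∀ x →
    cycleAdj E g x ≈ cycleAdj E h x
  cycleAdj-cong E g≈h x = +-cong (when-cong _ (g≈h (inc x))) (when-cong _ (g≈h (dec x)))

  cycleAdj-sum : ∀ E {n} (G : Fin n → Z4 → Carrier) x →
    cycleAdj E (λ z → sum (λ j → G j z)) x ≈ sum (λ j → cycleAdj E (G j) x)
  cycleAdj-sum E G x =
    trans (+-cong (when-sum a (λ j → G j (inc x))) (when-sum a′ (λ j → G j (dec x))))
          (sym (∑-distrib-+ (λ j → when a (G j (inc x))) (λ j → when a′ (G j (dec x)))))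
    where
    a = E x (inc x)
    a′ = E x (dec x)

  cycleAdj-comm : ∀ E F (h : Z4 → Z4 → Carrier) x y →
    cycleAdj E (λ z → cycleAdj F (h z) y) x ≈ cycleAdj F (λ z′ → cycleAdj E (λ z → h z z′) x) y
  cycleAdj-comm E F h x y = begin
      when a (when b X + when b′ Y) + when a′ (when b Z + when b′ W)
    ≈⟨ +-cong (when-+ a _ _) (when-+ a′ _ _) ⟩
      (when a (when b X) + when a (when b′ Y)) + (when a′ (when b Z) + when a′ (when b′ W))
    ≈⟨ interchange _ _ _ _ ⟩
      (when a (when b X) + when a′ (when b Z)) + (when a (when b′ Y) + when a′ (when b′ W))
    ≡⟨ ≡.cong₂ _+_ (≡.cong₂ _+_ (when-comm a b X) (when-comm a′ b Z))
                   (≡.cong₂ _+_ (when-comm a b′ Y) (when-comm a′ b′ W)) ⟩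
      (when b (when a X) + when b (when a′ Z)) + (when b′ (when a Y) + when b′ (when a′ W))
    ≈⟨ +-cong (when-+ b _ _) (when-+ b′ _ _) ⟨
      when b (when a X + when a′ Z) + when b′ (when a Y + when a′ W)
    ∎
    where
    a = E x (inc x)
    a′ = E x (dec x)
    b = F y (inc y)
    b′ = F y (dec y)
    X = h (inc x) (inc y)
    Y = h (inc x) (dec y)
    Z = h (dec x) (inc y)
    W = h (dec x) (dec y)

  cycle-commutator : ∀ (g : Z4 → Carrier) x →
    cycleAdj outward (cycleAdj inward g) x + absZ4 x × (g x + g x)
      ≈ (g x + g x) + cycleAdj inward (cycleAdj outward g) x
  cycle-commutator g zero =
    solve 1 (λ a → ((id ⊕ a) ⊕ (a ⊕ id)) ⊕ id ⊜ (a ⊕ a) ⊕ (id ⊕ id)) refl (g zero)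
  cycle-commutator g (suc zero) =
    solve 2 (λ a b → ((b ⊕ a) ⊕ id) ⊕ ((a ⊕ a) ⊕ id) ⊜ (a ⊕ a) ⊕ (id ⊕ (a ⊕ b))) refl
      (g (suc zero)) (g (suc (suc (suc zero))))
  cycle-commutator g (suc (suc zero)) =
    solve 1 (λ a → (id ⊕ id) ⊕ ((a ⊕ a) ⊕ ((a ⊕ a) ⊕ id)) ⊜ (a ⊕ a) ⊕ ((id ⊕ a) ⊕ (a ⊕ id)))
      refl (g (suc (suc zero)))
  cycle-commutator g (suc (suc (suc zero))) =
    solve 2 (λ a b → (id ⊕ (a ⊕ b)) ⊕ ((a ⊕ a) ⊕ id) ⊜ (a ⊕ a) ⊕ ((b ⊕ a) ⊕ id)) refl
      (g (suc (suc (suc zero)))) (g (suc zero))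

  axisAdj : (Z4 → Z4 → Bool) → ∀ {N} → Fin N → VFun N → VFun N
  axisAdj E k f v = cycleAdj E (λ z → f (v [ k ]≔ z)) (lookup v k)

  axisAdj-cong : ∀ E {N} (k : Fin N) {f g : VFun N} → (∀ w → f w ≈ g w) → ∀ v →
    axisAdj E k f v ≈ axisAdj E k g v
  axisAdj-cong E k f≈g v = cycleAdj-cong E (λ z → f≈g (v [ k ]≔ z)) (lookup v k)

  axisAdj-comm : ∀ E F {N} {k j : Fin N} → k ≢ j → ∀ (f : VFun N) v →
    axisAdj E k (axisAdj F j f) v ≈ axisAdj F j (axisAdj E k f) v
  axisAdj-comm E F {k = k} {j} k≢j f v = begin
      axisAdj E k (axisAdj F j f) v
    ≈⟨ cycleAdj-cong E (λ z → reflexive (≡.cong (cycleAdj F (h z))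
                                                (lookup∘updateAt′ j k {const z} (k≢j ∘ ≡.sym) v))) x ⟩
      cycleAdj E (λ z → cycleAdj F (h z) y) x
    ≈⟨ cycleAdj-comm E F h x y ⟩
      cycleAdj F (λ z′ → cycleAdj E (λ z → h z z′) x) y
    ≈⟨ cycleAdj-cong F (λ z′ → cycleAdj-cong E (λ z →
         reflexive (≡.cong f ([]≔-commutes {x = z} {y = z′} v k j k≢j))) x) y ⟩
      cycleAdj F (λ z′ → cycleAdj E (λ z → f (v [ j ]≔ z′ [ k ]≔ z)) x) y
    ≈⟨ cycleAdj-cong F (λ z′ → reflexive (≡.cong (cycleAdj E (λ z → f (v [ j ]≔ z′ [ k ]≔ z)))
                                                 (≡.sym (lookup∘updateAt′ k j {const z′} k≢j v)))) y ⟩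
      axisAdj F j (axisAdj E k f) v
    ∎
    where
    x = lookup v k
    y = lookup v j
    h : Z4 → Z4 → Carrier
    h z z′ = f (v [ k ]≔ z [ j ]≔ z′)

  axisAdj-twice : ∀ E F {N} (k : Fin N) (f : VFun N) v →
    axisAdj E k (axisAdj F k f) v ≈ cycleAdj E (cycleAdj F (λ z → f (v [ k ]≔ z))) (lookup v k)
  axisAdj-twice E F k f v = cycleAdj-cong E (λ z →
      trans (reflexive (≡.cong (cycleAdj F (λ z′ → f (v [ k ]≔ z [ k ]≔ z′)))
                               (lookup∘updateAt k {const z} v)))
            (cycleAdj-cong F (λ z′ → reflexive (≡.cong f ([]≔-idempotent {x = z} {y = z′} v k))) z))
    (lookup v k)

  axis-commutator : ∀ {N} (k : Fin N) (f : VFun N) v →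
    axisAdj outward k (axisAdj inward k f) v + absZ4 (lookup v k) × (f v + f v)
      ≈ (f v + f v) + axisAdj inward k (axisAdj outward k f) v
  axis-commutator k f v = begin
      axisAdj outward k (axisAdj inward k f) v + absZ4 x × (f v + f v)
    ≈⟨ +-cong (axisAdj-twice outward inward k f v)
              (reflexive (≡.cong (λ y → absZ4 x × (y + y)) f≡g)) ⟩
      cycleAdj outward (cycleAdj inward g) x + absZ4 x × (g x + g x)
    ≈⟨ cycle-commutator g x ⟩
      (g x + g x) + cycleAdj inward (cycleAdj outward g) x
    ≈⟨ +-cong (reflexive (≡.cong (λ y → y + y) f≡g)) (axisAdj-twice inward outward k f v) ⟨
      (f v + f v) + axisAdj inward k (axisAdj outward k f) v
    ∎
    where
    x = lookup v k
    g = λ z → f (v [ k ]≔ z)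
    f≡g : f v ≡ g x
    f≡g = ≡.cong f (≡.sym ([]≔-lookup v k))

  cubeAdj : (Z4 → Z4 → Bool) → ∀ {N} → VFun N → VFun N
  cubeAdj E f v = sum (λ k → axisAdj E k f v)

  nbrSum≡cubeAdj : ∀ {t} → ShiftInvariant t → ∀ {N} (f : VFun N) v →
    nbrSum (λ w → t (level v) (level w)) f v ≡ cubeAdj (onLevels t) f v
  nbrSum≡cubeAdj {t} inv {N} f v =
    ≡.trans (ΣFin≡sum {N} _) (sum-cong-≗ (λ k → ≡.cong₂ _+_ (shiftTerm k inc) (shiftTerm k dec)))
    where
    shiftTerm : ∀ k s →
      when (t (level v) (level (updateAt v k s))) (f (updateAt v k s))
        ≡ when (onLevels t (lookup v k) (s (lookup v k))) (f (v [ k ]≔ s (lookup v k)))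
    shiftTerm k s =
      ≡.trans (≡.cong (λ w → when (t (level v) (level w)) (f w)) (updateAt-cong-local k v ≡.refl))
              (≡.cong (λ b → when b _) (onLevels-[]≔ inv v k (s (lookup v k))))

  A₊≡cubeAdj : ∀ {N} (f : VFun N) v → A₊ f v ≡ cubeAdj inward f v
  A₊≡cubeAdj = nbrSum≡cubeAdj down-shiftInvariant

  A₋≡cubeAdj : ∀ {N} (f : VFun N) v → A₋ f v ≡ cubeAdj outward f v
  A₋≡cubeAdj = nbrSum≡cubeAdj up-shiftInvariant

  cubeAdj-cubeAdj : ∀ E F {N} {g : VFun N} (f : VFun N) → (∀ w → g w ≡ cubeAdj F f w) → ∀ v →
    cubeAdj E g v ≈ sum (λ k → sum (λ j → axisAdj E k (axisAdj F j f) v))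
  cubeAdj-cubeAdj E F f g≡ v = sum-cong-≋ λ k →
    trans (axisAdj-cong E k (λ w → reflexive (g≡ w)) v)
          (cycleAdj-sum E (λ j z → axisAdj F j f (v [ k ]≔ z)) (lookup v k))

  sum-level : ∀ {N} (v : Vertex N) y → sum (λ k → absZ4 (lookup v k) × y) ≈ level v × y
  sum-level []      y = refl
  sum-level (x ∷ v) y = trans (+-congˡ (sum-level v y)) (sym (×-homo-+ y (absZ4 x) (level v)))

  commutator-identity : ∀ {N} (f : VFun N) v →
    A₋ (A₊ f) v + level v × (f v + f v) ≈ N × (f v + f v) + A₊ (A₋ f) v
  commutator-identity {N} f v = begin
      A₋ (A₊ f) v + level v × y
    ≈⟨ +-cong (trans (reflexive (A₋≡cubeAdj (A₊ f) v))
                     (cubeAdj-cubeAdj outward inward f (A₊≡cubeAdj f) v))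
              (sym (sum-level v y)) ⟩
      sum (λ k → sum (outIn k)) + sum levelTerm
    ≈⟨ ∑-distrib-+ (λ k → sum (outIn k)) levelTerm ⟨
      sum (λ k → sum (outIn k) + levelTerm k)
    ≈⟨ sum-cong-≋ (λ k → sum-exchangeAt k
                           (λ j j≢k → axisAdj-comm outward inward (j≢k ∘ ≡.sym) f v)
                           (axis-commutator k f v)) ⟩
      sum (λ k → y + sum (λ j → inOut j k))
    ≈⟨ ∑-distrib-+ (replicate N y) (λ k → sum (λ j → inOut j k)) ⟩
      sum (replicate N y) + sum (λ k → sum (λ j → inOut j k))
    ≈⟨ +-cong (sum-replicate N) (∑-comm (λ k j → inOut j k)) ⟩
      N × y + sum (λ j → sum (inOut j))
    ≈⟨ +-congˡ (trans (reflexive (A₊≡cubeAdj (A₋ f) v))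
                      (cubeAdj-cubeAdj inward outward f (A₋≡cubeAdj f) v)) ⟨
      N × y + A₊ (A₋ f) v
    ∎
    where
    y = f v + f v
    outIn inOut : Fin N → Fin N → Carrier
    outIn k j = axisAdj outward k (axisAdj inward j f) v
    inOut j k = axisAdj inward j (axisAdj outward k f) v
    levelTerm : Fin N → Carrier
    levelTerm k = absZ4 (lookup v k) × y

  Cop-pointwise : ∀ {N} (f : VFun N) v → Cop f v ≈ (2 ℕ.* N) · f v - (2 ℕ.* level v) · f v
  Cop-pointwise {N} f v = begin
      A₋ (A₊ f) v - A₊ (A₋ f) v
    ≈⟨ x+a≈b+y⇒x-y≈b-a (commutator-identity f v) ⟩
      N × (f v + f v) - level v × (f v + f v)
    ≈⟨ +-cong (×-double N (f v)) (-‿cong (×-double (level v) (f v))) ⟩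
      (2 ℕ.* N) × f v - (2 ℕ.* level v) × f v
    ≡⟨ ≡.cong₂ _-_ (≡.sym (·≡× (2 ℕ.* N) (f v))) (≡.sym (·≡× (2 ℕ.* level v) (f v))) ⟩
      (2 ℕ.* N) · f v - (2 ℕ.* level v) · f v
    ∎

  Cop-supportedOnLevel : ∀ {N} r (f : VFun N) → (∀ v → level v ≢ r → f v ≈ 0#) → ∀ v →
    Cop f v ≈ (2 ℕ.* N) · f v - (2 ℕ.* r) · f v
  Cop-supportedOnLevel r f supported v with level v ℕₚ.≟ r
  ... | yes ≡.refl = Cop-pointwise f v
  ... | no d≢r = trans (Cop-pointwise f v)
                       (+-congˡ (-‿cong (trans (x≈0⇒n·x≈0 (2 ℕ.* level v) fv≈0)
                                               (sym (x≈0⇒n·x≈0 (2 ℕ.* r) fv≈0)))))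
    where
    fv≈0 = supported v d≢r

mainTheorem7 : {c ℓ : Level} (R : CommutativeRing c ℓ) →
    let open CommutativeRing R in
    let open Cube R in
    (N r : ℕ) → 1 ℕ.≤ N → r ℕ.≤ 2 ℕ.* N →
    (f : VFun N) → ((v : Vertex N) → level v ≢ r → f v ≈ 0#) →
    (v : Vertex N) → Cop f v ≈ (2 ℕ.* N) · f v - (2 ℕ.* r) · f v
mainTheorem7 R N r _ _ = Cop-supportedOnLevel R r
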